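{- Let $N = p_1p_2\cdots p_\ell$ be a product of $\ell \geq 2$ distinct primes. Then there exist distinct primes $p$ and $q$ dividing $N$ such that $h_N = h_{pq}$. Moreover, if $N \notin S$, then $p$ and $q$ can be chosen such that additionally $pq \notin S$.
   Context: For a positive integer $M$ with distinct prime divisors $q_1,\dots,q_m$, define $h_M = \tfrac{1}{2}\gcd\{q_1-1,\dots,q_m-1,24\}$. The set $S$ is defined as \[S = \Big\{ \prod_{i=1}^{\ell} p_i^{e_i} \;:\; \text{each } p_i>5 \text{ is prime with } p_i \equiv 1 \text{ or } 5 \pmod{24}, \text{ and at least one } p_i \equiv 5 \pmod{24}\Big\}.\] -}

module Defs where

open import Data.Nat using (ℕ; zero; suc; _∸_; _^_; _<_; _≤_; _%_)
open import Data.Nat.GCD using (gcd)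
open import Data.Nat.Divisibility using (_∣_; _∣?_)
open import Data.Nat.Primality using (Prime; prime?)
open import Data.List using (List; []; _∷_; map; foldr; filter; upTo)
open import Data.Nat.ListAction using (product)
open import Data.List.Relation.Unary.All using (All)
open import Data.List.Relation.Unary.Any using (Any)
open import Data.Product using (_×_; _,_; ∃; proj₁; proj₂)
open import Data.Sum using (_⊎_)
open import Data.Integer using (+_)
open import Data.Rational.Unnormalised using (ℚᵘ; _/_)
open import Relation.Binary.PropositionalEquality using (_≡_)
open import Relation.Nullary.Decidable using (_×-dec_)

primeDivisors : ℕ → List ℕ
primeDivisors M = filter (λ q → prime? q ×-dec (q ∣? M)) (upTo (suc M))

gcdH : ℕ → ℕ
gcdH M = foldr gcd 24 (map (λ q → q ∸ 1) (primeDivisors M))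

h : ℕ → ℚᵘ
h M = (+ gcdH M) / 2

AdmissibleS : ℕ → Set
AdmissibleS p = Prime p × 5 < p × (p % 24 ≡ 1 ⊎ p % 24 ≡ 5)

InS : ℕ → Set
InS n = ∃ λ (fs : List (ℕ × ℕ)) →
          All (λ pe → AdmissibleS (proj₁ pe) × 1 ≤ proj₂ pe) fs
        × Any (λ pe → proj₁ pe % 24 ≡ 5) fs
        × n ≡ product (map (λ pe → proj₁ pe ^ proj₂ pe) fs)

{-# OPTIONS --safe #-}
module Submission where

-- Write γ q = gcd (q - 1) 24, so that h_N is half the gcd of the γ q over the primes q ∣ N.
-- All γ q divide 24 = 2³·3, and among any three divisors of 24 the gcd of some two divides the
-- third; by induction on ℓ this yields distinct p, q ∣ N with gcd (γ p) (γ q) dividing every γ r,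
-- i.e. h_N = h_pq. For the second part, such a pair is either already outside S or can be
-- traded for one containing a non-admissible prime factor of N, which exists because N ∉ S.

open import Defs
open import Data.Nat
  using (ℕ; suc; zero; _+_; _*_; _∸_; _^_; _%_; _/_; _≤_; _<?_; _≟_; NonZero; s≤s; z≤n)
open import Data.Nat.Properties using (*-identityʳ; m*n≢0; +-∸-comm; ≤-<-trans; m∸n≤m)
open import Data.Nat.DivMod using (m≡m%n+[m/n]*n; %-congˡ; [m+kn]%n≡m%n; m<n⇒m%n≡m; m%n<n)
open import Data.Nat.GCD using (gcd; gcd[m,n]∣m; gcd[m,n]∣n; gcd-greatest; gcd-universality)
open import Data.Nat.Divisibility
  using (_∣_; _∤_; _∣?_; ∣-refl; ∣-trans; ∣-antisym; ∣⇒≤; ∣1⇒≡1; m∣m*n; n∣m*n; divides; %-presˡ-∣; ∣n∣m%n⇒∣m)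
open import Data.Nat.Primality
  using (Prime; prime?; euclidsLemma; prime⇒irreducible; ¬prime[1]; productOfPrimes≢0; prime⇒nonZero)
open import Data.Nat.ListAction using (product)
open import Data.Nat.ListAction.Properties using (∈⇒∣product)
open import Data.List using (List; []; _∷_; length; map; foldr; upTo)
open import Data.List.Relation.Unary.All using (All; []; _∷_; lookup; all?; tabulate)
import Data.List.Relation.Unary.All as All
import Data.List.Relation.Unary.All.Properties as All
open import Data.List.Relation.Unary.Any using (Any; here; there)
import Data.List.Relation.Unary.Any.Properties as Any
open import Data.List.Relation.Unary.AllPairs using ([]; _∷_)
open import Data.List.Relation.Unary.Unique.Propositional using (Unique)
open import Data.List.Membership.Propositional using (_∈_; find; lose)
open import Data.List.Membership.Propositional.Properties using (∈-filter⁺; ∈-filter⁻; ∈-upTo⁺; ∈-map⁺)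
open import Data.List.Membership.DecPropositional _≟_ using (_∈?_)
open import Data.Product using (_×_; _,_; ∃; ∃₂; proj₁; proj₂)
open import Data.Sum using (_⊎_; inj₁; inj₂)
open import Data.Integer using (+_)
open import Data.Rational.Unnormalised as ℚᵘ using (_≃_)
open import Data.Rational.Unnormalised.Properties using (≃-reflexive)
open import Relation.Binary.PropositionalEquality
  using (_≡_; _≢_; refl; sym; trans; cong; cong₂; subst; module ≡-Reasoning)
open import Relation.Nullary using (¬_; Dec; yes; no; contradiction)
open import Relation.Nullary.Decidable using (from-yes; _×-dec_; _⊎-dec_; _→-dec_)

prime∤1 : ∀ {p} → Prime p → p ∤ 1
prime∤1 p-prime p∣1 = ¬prime[1] (subst Prime (∣1⇒≡1 p∣1) p-prime)

prime∣prime⇒≡ : ∀ {p q} → Prime p → Prime q → p ∣ q → p ≡ q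
prime∣prime⇒≡ p-prime q-prime p∣q with prime⇒irreducible q-prime p∣q
... | inj₁ refl = contradiction p-prime ¬prime[1]
... | inj₂ p≡q  = p≡q

prime∣m^n⇒∣m : ∀ {p} m n → Prime p → p ∣ m ^ n → p ∣ m
prime∣m^n⇒∣m m zero    p-prime p∣1 = contradiction p∣1 (prime∤1 p-prime)
prime∣m^n⇒∣m m (suc n) p-prime p∣m^1+n with euclidsLemma m (m ^ n) p-prime p∣m^1+n
... | inj₁ p∣m   = p∣m
... | inj₂ p∣m^n = prime∣m^n⇒∣m m n p-prime p∣m^n

prime∣product⇒any∣ : ∀ {p} ns → Prime p → p ∣ product ns → Any (p ∣_) ns
prime∣product⇒any∣ []       p-prime p∣1 = contradiction p∣1 (prime∤1 p-prime)
prime∣product⇒any∣ (n ∷ ns) p-prime p∣n*Π with euclidsLemma n (product ns) p-prime p∣n*Π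
... | inj₁ p∣n = here p∣n
... | inj₂ p∣Π = there (prime∣product⇒any∣ ns p-prime p∣Π)

prime∣product[primes]⇒∈ : ∀ {p ps} → All Prime ps → Prime p → p ∣ product ps → p ∈ ps
prime∣product[primes]⇒∈ {ps = ps} ps-prime p-prime p∣Π =
  let q , q∈ps , p∣q = find (prime∣product⇒any∣ ps p-prime p∣Π)
  in subst (_∈ ps) (sym (prime∣prime⇒≡ p-prime (lookup ps-prime q∈ps) p∣q)) q∈ps

prime∣m*n⇒≡m⊎≡n : ∀ {p m n} → Prime p → Prime m → Prime n → p ∣ m * n → p ≡ m ⊎ p ≡ n
prime∣m*n⇒≡m⊎≡n {m = m} {n} p-prime m-prime n-prime p∣mn with euclidsLemma m n p-prime p∣mn
... | inj₁ p∣m = inj₁ (prime∣prime⇒≡ p-prime m-prime p∣m)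
... | inj₂ p∣n = inj₂ (prime∣prime⇒≡ p-prime n-prime p∣n)

gcd[m%n,n]≡gcd[m,n] : ∀ m n .{{_ : NonZero n}} → gcd (m % n) n ≡ gcd m n
gcd[m%n,n]≡gcd[m,n] m n = sym (gcd-universality
  (λ (d∣m%n , d∣n) → gcd-greatest (∣n∣m%n⇒∣m d∣n d∣m%n) d∣n)
  (λ d∣gcd → let d∣m = ∣-trans d∣gcd (gcd[m,n]∣m m n); d∣n = ∣-trans d∣gcd (gcd[m,n]∣n m n)
             in %-presˡ-∣ d∣m d∣n , d∣n))

foldr-gcd∣init : ∀ n ms → foldr gcd n ms ∣ n
foldr-gcd∣init n []       = ∣-refl
foldr-gcd∣init n (m ∷ ms) = ∣-trans (gcd[m,n]∣n m _) (foldr-gcd∣init n ms)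

foldr-gcd∣all : ∀ n ms → All (foldr gcd n ms ∣_) ms
foldr-gcd∣all n []       = []
foldr-gcd∣all n (m ∷ ms) =
  gcd[m,n]∣m m _ ∷ All.map (∣-trans (gcd[m,n]∣n m _)) (foldr-gcd∣all n ms)

∣foldr-gcd : ∀ {d n ms} → d ∣ n → All (d ∣_) ms → d ∣ foldr gcd n ms
∣foldr-gcd d∣n []             = d∣n
∣foldr-gcd d∣n (d∣m ∷ d∣ms) = gcd-greatest d∣m (∣foldr-gcd d∣n d∣ms)

PairGcdDividesThird : ℕ → ℕ → ℕ → Set
PairGcdDividesThird a b c = gcd a b ∣ c ⊎ gcd a c ∣ b ⊎ gcd b c ∣ a

pairGcdDividesThird? : ∀ a b c → Dec (PairGcdDividesThird a b c)
pairGcdDividesThird? a b c = gcd a b ∣? c ⊎-dec gcd a c ∣? b ⊎-dec gcd b c ∣? a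

divisors24 : List ℕ
divisors24 = 1 ∷ 2 ∷ 3 ∷ 4 ∷ 6 ∷ 8 ∷ 12 ∷ 24 ∷ []

∣24⇒∈divisors24 : ∀ {d} → d ∣ 24 → d ∈ divisors24
∣24⇒∈divisors24 d∣24 = lookup upTo25-checked (∈-upTo⁺ (s≤s (∣⇒≤ d∣24))) d∣24
  where
  upTo25-checked : All (λ d → d ∣ 24 → d ∈ divisors24) (upTo 25)
  upTo25-checked = from-yes (all? (λ d → d ∣? 24 →-dec d ∈? divisors24) (upTo 25))

-- The divisors of 24 = 2³·3 form a product of two chains, and gcd is the componentwise
-- minimum. In each coordinate at most one of a, b, c is the strict minimum, so some element
-- is neither, and the gcd of the other two divides it.
pairGcdDividesThird-∣24 : ∀ {a b c} → a ∣ 24 → b ∣ 24 → c ∣ 24 → PairGcdDividesThird a b c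
pairGcdDividesThird-∣24 a∣24 b∣24 c∣24 =
  lookup (lookup (lookup all-triples (∣24⇒∈divisors24 a∣24)) (∣24⇒∈divisors24 b∣24)) (∣24⇒∈divisors24 c∣24)
  where
  all-triples : All (λ a → All (λ b → All (PairGcdDividesThird a b) divisors24) divisors24) divisors24
  all-triples = from-yes
    (all? (λ a → all? (λ b → all? (pairGcdDividesThird? a b) divisors24) divisors24) divisors24)

module _ {A : Set} (f : A → ℕ) where

  GcdAttainedBy : List A → A → A → Set
  GcdAttainedBy xs p q = All (λ x → gcd (f p) (f q) ∣ f x) xs

  GcdAttainedBy-∣ : ∀ {xs p q r s} → gcd (f r) (f s) ∣ gcd (f p) (f q) →
                    GcdAttainedBy xs p q → GcdAttainedBy xs r s
  GcdAttainedBy-∣ rs∣pq = All.map (∣-trans rs∣pq)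

  gcdAttainingPair : (∀ x y z → PairGcdDividesThird (f x) (f y) (f z)) →
                     ∀ xs → Unique xs → 2 ≤ length xs →
                     ∃₂ λ p q → p ∈ xs × q ∈ xs × p ≢ q × GcdAttainedBy xs p q
  gcdAttainingPair triple (a ∷ []) _ (s≤s ())
  gcdAttainingPair triple (a ∷ b ∷ []) ((a≢b ∷ []) ∷ _) _ =
    a , b , here refl , there (here refl) , a≢b ,
    gcd[m,n]∣m (f a) (f b) ∷ gcd[m,n]∣n (f a) (f b) ∷ []
  gcdAttainingPair triple (a ∷ xs@(_ ∷ _ ∷ _)) (a∉xs ∷ xs-unique) _
    with p , q , p∈ , q∈ , p≢q , attained ← gcdAttainingPair triple xs xs-unique (s≤s (s≤s z≤n))
    with triple a p q
  ... | inj₁ ap∣q = a , p , here refl , there p∈ , lookup a∉xs p∈ ,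
    gcd[m,n]∣m (f a) (f p) ∷ GcdAttainedBy-∣ (gcd-greatest (gcd[m,n]∣n (f a) (f p)) ap∣q) attained
  ... | inj₂ (inj₁ aq∣p) = a , q , here refl , there q∈ , lookup a∉xs q∈ ,
    gcd[m,n]∣m (f a) (f q) ∷ GcdAttainedBy-∣ (gcd-greatest aq∣p (gcd[m,n]∣n (f a) (f q))) attained
  ... | inj₂ (inj₂ pq∣a) = p , q , there p∈ , there q∈ , p≢q , pq∣a ∷ attained

γ : ℕ → ℕ
γ t = gcd (t ∸ 1) 24

γ∣24 : ∀ t → γ t ∣ 24
γ∣24 t = gcd[m,n]∣n (t ∸ 1) 24

γ-pairGcdDividesThird : ∀ x y z → PairGcdDividesThird (γ x) (γ y) (γ z)
γ-pairGcdDividesThird x y z = pairGcdDividesThird-∣24 (γ∣24 x) (γ∣24 y) (γ∣24 z)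

[m∸1]%n≡m%n∸1 : ∀ m n .{{_ : NonZero n}} → 1 ≤ m % n → (m ∸ 1) % n ≡ m % n ∸ 1
[m∸1]%n≡m%n∸1 m n 1≤m%n = begin
  (m ∸ 1) % n                 ≡⟨ %-congˡ (cong (_∸ 1) (m≡m%n+[m/n]*n m n)) ⟩
  (m % n + m / n * n ∸ 1) % n ≡⟨ %-congˡ (+-∸-comm (m / n * n) 1≤m%n) ⟩
  (m % n ∸ 1 + m / n * n) % n ≡⟨ [m+kn]%n≡m%n (m % n ∸ 1) (m / n) n ⟩
  (m % n ∸ 1) % n             ≡⟨ m<n⇒m%n≡m (≤-<-trans (m∸n≤m (m % n) 1) (m%n<n m n)) ⟩
  m % n ∸ 1                   ∎
  where open ≡-Reasoning

γ-by-residue : ∀ {t r} → t % 24 ≡ suc r → γ t ≡ gcd r 24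
γ-by-residue {t} {r} t%24≡1+r = begin
  gcd (t ∸ 1) 24        ≡⟨ gcd[m%n,n]≡gcd[m,n] (t ∸ 1) 24 ⟨
  gcd ((t ∸ 1) % 24) 24 ≡⟨ cong (λ m → gcd m 24) ([m∸1]%n≡m%n∸1 t 24 1≤t%24) ⟩
  gcd (t % 24 ∸ 1) 24   ≡⟨ cong (λ m → gcd (m ∸ 1) 24) t%24≡1+r ⟩
  gcd r 24              ∎
  where
  open ≡-Reasoning
  1≤t%24 : 1 ≤ t % 24
  1≤t%24 = subst (1 ≤_) (sym t%24≡1+r) (s≤s z≤n)

4∣γ-admissible : ∀ {t} → AdmissibleS t → 4 ∣ γ t
4∣γ-admissible {t} (_ , _ , inj₁ t≡1) = subst (4 ∣_) (sym (γ-by-residue {t} t≡1)) (divides 6 refl)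
4∣γ-admissible {t} (_ , _ , inj₂ t≡5) = subst (4 ∣_) (sym (γ-by-residue {t} t≡5)) ∣-refl

∈primeDivisors : ∀ {M q} .{{_ : NonZero M}} → Prime q → q ∣ M → q ∈ primeDivisors M
∈primeDivisors {M} q-prime q∣M =
  ∈-filter⁺ (λ q → prime? q ×-dec q ∣? M) (∈-upTo⁺ (s≤s (∣⇒≤ q∣M))) (q-prime , q∣M)

∈primeDivisors⁻ : ∀ {M q} → q ∈ primeDivisors M → Prime q × q ∣ M
∈primeDivisors⁻ {M} q∈ = proj₂ (∈-filter⁻ (λ q → prime? q ×-dec q ∣? M) {xs = upTo (suc M)} q∈)

gcdH∣24 : ∀ M → gcdH M ∣ 24
gcdH∣24 M = foldr-gcd∣init 24 (map (_∸ 1) (primeDivisors M))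

gcdH∣γ : ∀ {M q} .{{_ : NonZero M}} → Prime q → q ∣ M → gcdH M ∣ γ q
gcdH∣γ {M} q-prime q∣M = gcd-greatest
  (lookup (All.map⁻ (foldr-gcd∣all 24 (map (_∸ 1) (primeDivisors M)))) (∈primeDivisors q-prime q∣M))
  (gcdH∣24 M)

∣gcdH : ∀ {M d} → d ∣ 24 → (∀ {q} → Prime q → q ∣ M → d ∣ γ q) → d ∣ gcdH M
∣gcdH d∣24 d∣γ = ∣foldr-gcd d∣24 (All.map⁺ (tabulate λ q∈ →
  let q-prime , q∣M = ∈primeDivisors⁻ q∈ in ∣-trans (d∣γ q-prime q∣M) (gcd[m,n]∣m _ 24)))

gcdH-attained : ∀ {ps p q} → All Prime ps → p ∈ ps → q ∈ ps → GcdAttainedBy γ ps p q →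
                gcdH (product ps) ≡ gcdH (p * q)
gcdH-attained {ps} {p} {q} ps-prime p∈ q∈ attained = ∣-antisym
  (∣gcdH (gcdH∣24 N) λ r-prime r∣pq → gcdH∣γ r-prime (∈⇒∣product (factor∈ps r-prime r∣pq)))
  (∣gcdH (gcdH∣24 (p * q)) λ r-prime r∣N →
    ∣-trans (gcd-greatest (gcdH∣γ p-prime (m∣m*n q)) (gcdH∣γ q-prime (n∣m*n p)))
            (lookup attained (prime∣product[primes]⇒∈ ps-prime r-prime r∣N)))
  where
  N = product ps
  p-prime = lookup ps-prime p∈
  q-prime = lookup ps-prime q∈
  instance
    N≢0 : NonZero N
    N≢0 = productOfPrimes≢0 ps-prime
    pq≢0 : NonZero (p * q)
    pq≢0 = m*n≢0 p q {{prime⇒nonZero p-prime}} {{prime⇒nonZero q-prime}}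
  factor∈ps : ∀ {r} → Prime r → r ∣ p * q → r ∈ ps
  factor∈ps r-prime r∣pq with prime∣m*n⇒≡m⊎≡n r-prime p-prime q-prime r∣pq
  ... | inj₁ refl = p∈
  ... | inj₂ refl = q∈

power : ℕ × ℕ → ℕ
power (f , e) = f ^ e

admissible? : ∀ p → Dec (AdmissibleS p)
admissible? p = prime? p ×-dec 5 <? p ×-dec (p % 24 ≟ 1 ⊎-dec p % 24 ≟ 5)

prime∣InS⇒admissible : ∀ {n p} → InS n → Prime p → p ∣ n → AdmissibleS p
prime∣InS⇒admissible (fs , fs-admissible , _ , refl) p-prime p∣n =
  let (f , e) , fe∈fs , p∣f^e = find (Any.map⁻ {f = power} (prime∣product⇒any∣ _ p-prime p∣n))
      f-admissible , _ = lookup fs-admissible fe∈fs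
      p≡f = prime∣prime⇒≡ p-prime (proj₁ f-admissible) (prime∣m^n⇒∣m f e p-prime p∣f^e)
  in subst AdmissibleS (sym p≡f) f-admissible

nonadmissible∣⇒∉S : ∀ {n p} → Prime p → ¬ AdmissibleS p → p ∣ n → ¬ InS n
nonadmissible∣⇒∉S p-prime p-bad p∣n n∈S = p-bad (prime∣InS⇒admissible n∈S p-prime p∣n)

InS⇒prime≡5[24]∣ : ∀ {n} → InS n → ∃ λ f → Prime f × f % 24 ≡ 5 × f ∣ n
InS⇒prime≡5[24]∣ (fs , fs-admissible , some≡5 , refl) with find some≡5
... | (f , suc e) , fe∈fs , f≡5 = f , proj₁ (proj₁ (lookup fs-admissible fe∈fs)) , f≡5 ,
  ∣-trans (m∣m*n (f ^ e)) (∈⇒∣product (∈-map⁺ power fe∈fs))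
... | (f , zero) , fe∈fs , _ with () ← proj₂ (lookup fs-admissible fe∈fs)

≡1[24]*≡1[24]∉S : ∀ {p q} → Prime p → Prime q → p % 24 ≡ 1 → q % 24 ≡ 1 → ¬ InS (p * q)
≡1[24]*≡1[24]∉S p-prime q-prime p≡1 q≡1 pq∈S
  with f , f-prime , f≡5 , f∣pq ← InS⇒prime≡5[24]∣ pq∈S
  with prime∣m*n⇒≡m⊎≡n f-prime p-prime q-prime f∣pq
... | inj₁ refl = contradiction (trans (sym p≡1) f≡5) λ ()
... | inj₂ refl = contradiction (trans (sym q≡1) f≡5) λ ()

admissible-product∈S : ∀ {ps} → All AdmissibleS ps → Any (λ s → s % 24 ≡ 5) ps → InS (product ps)
admissible-product∈S {ps} ps-admissible some≡5 =
  map (_, 1) ps ,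
  All.map⁺ (All.map (_, s≤s z≤n) ps-admissible) ,
  Any.map⁺ some≡5 ,
  product≡product[^1] ps
  where
  product≡product[^1] : ∀ ns → product ns ≡ product (map power (map (_, 1) ns))
  product≡product[^1] []       = refl
  product≡product[^1] (n ∷ ns) = cong₂ _*_ (sym (*-identityʳ n)) (product≡product[^1] ns)

∉S⇒nonadmissible-factor : ∀ {ps} → ¬ InS (product ps) → Any (λ s → s % 24 ≡ 5) ps →
                          ∃ λ r → r ∈ ps × ¬ AdmissibleS r
∉S⇒nonadmissible-factor {ps} Π∉S some≡5 =
  find (All.¬All⇒Any¬ admissible? ps λ all-adm → Π∉S (admissible-product∈S all-adm some≡5))

AttainingPairOutsideS : List ℕ → Set
AttainingPairOutsideS ps = ∃₂ λ r s → r ∈ ps × s ∈ ps × r ≢ s × GcdAttainedBy γ ps r s × ¬ InS (r * s)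

-- As s ≡ 5 (mod 24) is admissible and N ∉ S, some prime factor r of N is not admissible;
-- and gcd (γ r) (γ s) ∣ γ s = 4 ∣ gcd (γ p) (γ q), so (r, s) still attains the gcd.
swapInNonadmissible : ∀ {ps p q s} → All Prime ps → ¬ InS (product ps) →
                      GcdAttainedBy γ ps p q → AdmissibleS p → AdmissibleS q →
                      s ∈ ps → AdmissibleS s → s % 24 ≡ 5 → AttainingPairOutsideS ps
swapInNonadmissible {ps} {p} {q} {s} ps-prime N∉S attained p-adm q-adm s∈ s-adm s≡5
  with r , r∈ , r-bad ← ∉S⇒nonadmissible-factor N∉S (lose s∈ s≡5)
  = r , s , r∈ , s∈ , (λ r≡s → r-bad (subst AdmissibleS (sym r≡s) s-adm)) ,
  GcdAttainedBy-∣ γ {ps} {p} {q} {r} {s} (∣-trans (gcd[m,n]∣n (γ r) (γ s)) γs∣gcd[γp,γq]) attained ,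
  nonadmissible∣⇒∉S (lookup ps-prime r∈) r-bad (m∣m*n s)
  where
  γs∣gcd[γp,γq] : γ s ∣ gcd (γ p) (γ q)
  γs∣gcd[γp,γq] = subst (_∣ gcd (γ p) (γ q)) (sym (γ-by-residue {s} s≡5))
    (gcd-greatest (4∣γ-admissible p-adm) (4∣γ-admissible q-adm))

attainingPairOutsideS : ∀ {ps p q} → All Prime ps → p ∈ ps → q ∈ ps → p ≢ q →
                        GcdAttainedBy γ ps p q → ¬ InS (product ps) → AttainingPairOutsideS ps
attainingPairOutsideS {ps} {p} {q} ps-prime p∈ q∈ p≢q attained N∉S
  with admissible? p | admissible? q
... | no p-bad | _ = p , q , p∈ , q∈ , p≢q , attained ,
  nonadmissible∣⇒∉S (lookup ps-prime p∈) p-bad (m∣m*n q)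
... | yes _ | no q-bad = p , q , p∈ , q∈ , p≢q , attained ,
  nonadmissible∣⇒∉S (lookup ps-prime q∈) q-bad (n∣m*n p)
... | yes p-adm | yes q-adm with proj₂ (proj₂ p-adm) | proj₂ (proj₂ q-adm)
...   | inj₁ p≡1 | inj₁ q≡1 = p , q , p∈ , q∈ , p≢q , attained ,
  ≡1[24]*≡1[24]∉S (lookup ps-prime p∈) (lookup ps-prime q∈) p≡1 q≡1
...   | inj₂ p≡5 | _        = swapInNonadmissible ps-prime N∉S attained p-adm q-adm p∈ p-adm p≡5
...   | inj₁ _   | inj₂ q≡5 = swapInNonadmissible ps-prime N∉S attained p-adm q-adm q∈ q-adm q≡5

h-attained : ∀ {ps p q} → All Prime ps → p ∈ ps → q ∈ ps → GcdAttainedBy γ ps p q →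
             h (product ps) ≃ h (p * q)
h-attained ps-prime p∈ q∈ attained =
  ≃-reflexive (cong (λ g → + g ℚᵘ./ 2) (gcdH-attained ps-prime p∈ q∈ attained))

mainTheorem3 : (ps : List ℕ) → All Prime ps → Unique ps → 2 ≤ length ps →
    (∃₂ λ p q → Prime p × Prime q × p ≢ q × p ∣ product ps × q ∣ product ps
        × h (product ps) ≃ h (p * q))
    × (¬ InS (product ps) →
        ∃₂ λ p q → Prime p × Prime q × p ≢ q × p ∣ product ps × q ∣ product ps
          × h (product ps) ≃ h (p * q) × ¬ InS (p * q))
mainTheorem3 ps ps-prime ps-distinct 2≤ℓ
  with p , q , p∈ , q∈ , p≢q , attained ← gcdAttainingPair γ γ-pairGcdDividesThird ps ps-distinct 2≤ℓ
  = (p , q , lookup ps-prime p∈ , lookup ps-prime q∈ , p≢q ,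
     ∈⇒∣product p∈ , ∈⇒∣product q∈ , h-attained ps-prime p∈ q∈ attained)
  , λ N∉S →
    let r , s , r∈ , s∈ , r≢s , attained′ , rs∉S = attainingPairOutsideS ps-prime p∈ q∈ p≢q attained N∉S
    in r , s , lookup ps-prime r∈ , lookup ps-prime s∈ , r≢s ,
       ∈⇒∣product r∈ , ∈⇒∣product s∈ , h-attained ps-prime r∈ s∈ attained′ , rs∉S
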